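{- Let $\mathcal{A}^*$ be a deterministic external memory algorithm for the matrix transpose problem on $n\times n$ matrices with $w$-bit entries (defined in the context) that makes at most $t$ I/Os on every input and is correct on at least half of all $2^{n^2w}$ input matrices. Then there exists a set $\Gamma$ of at least $$\frac{2^{n^2w}}{2\left(t+2n^2/B+1\right)^{t+1}}$$ distinct input matrices such that $\mathcal{A}^*$ is correct on every $A\in\Gamma$ and the I/O-graph of $\mathcal{A}^*$ is the same for all $A\in\Gamma$.
   Context: External memory model: internal memory of $M$ words of $w$ bits ($m=Mw$ bits), unbounded disk partitioned into blocks of $B$ words ($b=Bw$ bits); an I/O reads or writes one block; cost is number of I/Os; computation in memory is free and unrestricted. Matrix transpose problem: the input $n\times n$ matrix $A$ is stored in row-major order ($n/B$ blocks of $B$ consecutive entries per row, $n^2/B$ blocks total) and the output $A^T$ must be written as $n/B$ blocks per column of $A$, each containing $B$ consecutive entries of that column ($n^2/B$ output blocks). I/O-graph of a deterministic algorithm on an input: start with one block node per input block, one per output block, and one memory node; all live, block nodes with distinct labels. Process the I/Os in order. If the I/O is the first access to a disk block that is neither an input nor an output block, create a new live block node with a fresh label and an edge from the live memory node to it. Otherwise let $v$ be the live block node of that disk block; add an edge from $v$ to the live memory node, mark $v$ dead, create a new live block node $v'$ with the same label and an edge from the live memory node to $v'$. After every $m/b$ I/Os, mark the memory node dead, create a new live memory node and add an edge from the old to the new memory node. -}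

module Defs where

open import Data.Bool using (Bool; true; false; if_then_else_)
open import Data.Nat using (ℕ; zero; suc; _+_; _*_; _^_; _≤_; _<ᵇ_; _≡ᵇ_; NonZero)
open import Data.Nat.DivMod using (_/_)
open import Data.Nat.Divisibility using (_∣?_)
open import Data.Fin using (Fin; toℕ)
open import Data.Vec using (Vec; replicate; tabulate; concat; transpose; toList)
open import Data.List using (List; []; _∷_; _++_; length)
open import Data.Product using (_×_; _,_; proj₁; proj₂)
open import Relation.Nullary using (Dec; yes; no; does)
open import Relation.Binary.PropositionalEquality using (_≡_)
open import Data.List.Membership.Propositional using (_∈_)

Word : ℕ → Set
Word w = Vec Bool w

zeroWord : (w : ℕ) → Word w
zeroWord w = replicate w false

-- n × n matrix with w-bit entries (vector of rows)
Matrix : ℕ → ℕ → Set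
Matrix n w = Vec (Vec (Word w) n) n

-- a disk block: B words of w bits (b = Bw bits)
Block : ℕ → ℕ → Set
Block w B = Vec (Word w) B

-- internal memory: M words of w bits (m = Mw bits)
Mem : ℕ → ℕ → Set
Mem w M = Vec Bool (M * w)

Disk : ℕ → ℕ → Set
Disk w B = ℕ → Block w B

-- The algorithm's whole state is its memory content; computation in
-- memory is free and unrestricted, so in each state it either halts,
-- reads a block at some address (new memory = arbitrary function of the
-- old memory and the block read), or writes a block (contents and new
-- memory arbitrary functions of the old memory).

data Action (w B M : ℕ) : Set where
  halt  : Action w B M
  read  : (addr : ℕ) → (Block w B → Mem w M) → Action w B M
  write : (addr : ℕ) → Block w B → Mem w M → Action w B M

record Algorithm (w B M : ℕ) : Set where
  field
    step : Mem w M → Action w B M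
open Algorithm public

initMem : (w M : ℕ) → Mem w M
initMem w M = replicate (M * w) false

updateDisk : ∀ {w B} → Disk w B → ℕ → Block w B → Disk w B
updateDisk d a b x = if x ≡ᵇ a then b else d x

record Run (w B : ℕ) : Set where
  constructor mkRun
  field
    halted : Bool
    trace  : List ℕ
    disk   : Disk w B
open Run public

run : ∀ {w B M} → Algorithm w B M → ℕ → Mem w M → Disk w B → Run w B
run alg fuel mem d with step alg mem
... | halt = mkRun true [] d
run alg zero    mem d | read a k    = mkRun false [] d
run alg zero    mem d | write a b m = mkRun false [] d
run alg (suc f) mem d | read a k    =
  let r = run alg f (k (d a)) d in mkRun (halted r) (a ∷ trace r) (disk r)
run alg (suc f) mem d | write a b m =
  let r = run alg f m (updateDisk d a b) in mkRun (halted r) (a ∷ trace r) (disk r)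

-- With N = n²/B: disk addresses 0 … N-1 hold the input blocks in
-- row-major order (block a holds row-major entries aB … aB+B-1);
-- addresses N … 2N-1 are the output blocks: address N+c must hold the
-- entries cB … cB+B-1 of Aᵀ in row-major order, i.e. B consecutive
-- entries of a column of A (n/B blocks per column).

nthW : ∀ {w} → List (Word w) → ℕ → Word w
nthW {w} []       _       = zeroWord w
nthW     (x ∷ xs) zero    = x
nthW     (x ∷ xs) (suc k) = nthW xs k

flat : ∀ {n w} → Matrix n w → List (Word w)
flat A = toList (concat A)

blockOf : ∀ {n w} (B : ℕ) → Matrix n w → ℕ → Block w B
blockOf B A k = tabulate (λ (r : Fin B) → nthW (flat A) (k * B + toℕ r))

nBlocks : (n B : ℕ) → .{{NonZero B}} → ℕ
nBlocks n B = (n * n) / B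

initDisk : ∀ {n w} (B : ℕ) → .{{_ : NonZero B}} → Matrix n w → Disk w B
initDisk {n} {w} B A a =
  if a <ᵇ nBlocks n B then blockOf B A a else replicate B (zeroWord w)

runOn : ∀ {n w B M} → .{{_ : NonZero B}} → Algorithm w B M → ℕ → Matrix n w → Run w B
runOn {n} {w} {B} {M} alg t A = run alg t (initMem w M) (initDisk B A)

HaltsWithin : ∀ {n w B M} → .{{_ : NonZero B}} → Algorithm w B M → ℕ → Matrix n w → Set
HaltsWithin alg t A = halted (runOn alg t A) ≡ true

Correct : ∀ {n w B M} → .{{_ : NonZero B}} → Algorithm w B M → ℕ → Matrix n w → Set
Correct {n} {w} {B} alg t A =
  HaltsWithin alg t A ×
  (∀ c → c Data.Nat.< nBlocks n B →
     disk (runOn alg t A) (nBlocks n B + c) ≡ blockOf B (transpose A) c)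

-- Labels: input block at address a < N has label a, output block at
-- address N+c has label N+c; the k-th distinct other disk block accessed
-- receives the fresh label 2N+k.  A block node is identified by its
-- label and a version number (0 for the initial node, incremented each
-- time a new node with the same label is created); memory nodes are
-- numbered 0,1,2,… in order of creation.

data Node : Set where
  blk : (label version : ℕ) → Node
  mem : (index : ℕ) → Node

Edge : Set
Edge = Node × Node

record IOGraph : Set where
  constructor mkG
  field
    nodes : List Node
    edges : List Edge
open IOGraph public

record GState : Set where
  constructor mkS
  field
    seen   : List ℕ      -- non-input/output addresses accessed so far, in order
    ver    : ℕ → ℕ       -- current (live) version of each label
    memIx  : ℕ
    count  : ℕ
    gnodes : List Node
    gedges : List Edge
open GState public

indexOf : ℕ → List ℕ → ℕ → Bool × ℕ
indexOf a []       i = false , i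
indexOf a (x ∷ xs) i = if a ≡ᵇ x then (true , i) else indexOf a xs (suc i)

setVer : (ℕ → ℕ) → ℕ → ℕ → (ℕ → ℕ)
setVer f l v x = if x ≡ᵇ l then v else f x

-- process one I/O; N = number of input blocks, e = m/b = M/B
ioStep : (N e : ℕ) → GState → ℕ → GState
ioStep N e s a = epoch (access s)
  where
  mn : Node
  mn = mem (memIx s)

  existing : ℕ → GState → GState
  existing l s' =
    let v  = ver s' l
    in mkS (seen s') (setVer (ver s') l (suc v)) (memIx s') (count s')
           (gnodes s' ++ (blk l (suc v) ∷ []))
           (gedges s' ++ ((blk l v , mn) ∷ (mn , blk l (suc v)) ∷ []))

  fresh : GState → GState
  fresh s' =
    let l = N + N + length (seen s')
    in mkS (seen s' ++ (a ∷ [])) (setVer (ver s') l 0) (memIx s') (count s')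
           (gnodes s' ++ (blk l 0 ∷ []))
           (gedges s' ++ ((mn , blk l 0) ∷ []))

  access : GState → GState
  access s' with a <ᵇ (N + N) | indexOf a (seen s') 0
  ... | true  | _          = existing a s'
  ... | false | (true , k) = existing (N + N + k) s'
  ... | false | (false , _) = fresh s'

  epoch : GState → GState
  epoch s' with does (e ∣? suc (count s'))
  ... | false = mkS (seen s') (ver s') (memIx s') (suc (count s')) (gnodes s') (gedges s')
  ... | true  = mkS (seen s') (ver s') (suc (memIx s')) (suc (count s'))
                    (gnodes s' ++ (mem (suc (memIx s')) ∷ []))
                    (gedges s' ++ ((mem (memIx s') , mem (suc (memIx s'))) ∷ []))

initNodes : ℕ → List Node
initNodes zero    = []
initNodes (suc k) = initNodes k ++ (blk k 0 ∷ [])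

initGState : ℕ → GState
initGState N = mkS [] (λ _ → 0) 0 0 (initNodes (N + N) ++ (mem 0 ∷ [])) []

foldIO : (N e : ℕ) → GState → List ℕ → GState
foldIO N e s []       = s
foldIO N e s (a ∷ as) = foldIO N e (ioStep N e s a) as

ioGraphOfTrace : (N e : ℕ) → List ℕ → IOGraph
ioGraphOfTrace N e tr = let s = foldIO N e (initGState N) tr in mkG (gnodes s) (gedges s)

-- I/O-graph of the algorithm on input A (m/b = Mw/(Bw) = M/B)
ioGraph : ∀ {n w B M} → .{{_ : NonZero B}} → Algorithm w B M → ℕ → Matrix n w → IOGraph
ioGraph {n} {w} {B} {M} alg t A =
  ioGraphOfTrace (nBlocks n B) (M / B) (trace (runOn alg t A))

_≈G_ : IOGraph → IOGraph → Set
G ≈G H = (∀ x → (x ∈ nodes G → x ∈ nodes H) × (x ∈ nodes H → x ∈ nodes G)) ×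
         (∀ e → (e ∈ edges G → e ∈ edges H) × (e ∈ edges H → e ∈ edges G))

-- The I/O-graph of a run is determined by the sequence of labels of the block nodes its I/Os
-- access, an I/O that creates a fresh label contributing a marker instead; the disk addresses
-- themselves never matter.  Within t I/Os only the 2N input/output labels (N = n²/B) and at
-- most t fresh ones occur, so there are at most (t + 2N + 1)^(t+1) such sequences.  By
-- pigeonhole one of them is shared by at least a (t + 2N + 1)^(t+1)-th of the
-- ≥ 2^(n²w)/2 inputs on which the algorithm is correct.
module Submission where

open import Defs
open import Data.Nat using (ℕ; _+_; _*_; _^_; _≤_; NonZero)
open import Data.Nat.Divisibility using (_∣_)
open import Data.List using (List; length)
open import Data.List.Relation.Unary.All using (All)
open import Data.List.Relation.Unary.Unique.Propositional using (Unique)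
open import Data.List.Membership.Propositional using (_∈_)
open import Data.Product using (Σ; _×_)

open import Data.Bool using (true; false; T)
open import Data.Unit using (tt)
open import Data.Nat using (zero; suc; _<_; _<ᵇ_; _≡ᵇ_; z≤n; s≤s; _≟_)
open import Data.Nat.Properties
open import Data.Nat.Divisibility using (_∣?_)
open import Data.Nat.DivMod using (_/_)
open import Data.List using ([]; _∷_; _++_; [_]; map; filter; upTo; cartesianProductWith)
open import Data.List.Properties using (length-++; length-map; length-upTo; ≡-dec)
open import Data.List.Relation.Unary.Any using (here; there)
import Data.List.Relation.Unary.All as All
import Data.List.Relation.Unary.All.Properties as All
import Data.List.Relation.Unary.Unique.Propositional.Properties as Unique
open import Data.List.Relation.Binary.Sublist.Propositional.Properties
  using (filter⁺; filter-⊆; length-mono-≤)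
open import Data.List.Membership.Propositional.Properties
  using (∈-map⁺; ∈-upTo⁺; ∈-filter⁻; ∈-cartesianProductWith⁺)
open import Data.Maybe using (Maybe; just; nothing)
import Data.Maybe.Properties as Maybe
open import Data.Product using (∃-syntax; _,_; proj₁; proj₂)
open import Data.Sum using (inj₁; inj₂)
open import Relation.Nullary using (does; contradiction)
open import Relation.Unary using (Pred; Decidable)
open import Relation.Unary.Properties using (∁?)
open import Data.Nat.Tactic.RingSolver using (solve-∀)
open import Relation.Binary.Definitions using (DecidableEquality)
open import Relation.Binary.PropositionalEquality
  using (_≡_; refl; sym; trans; cong; cong₂; subst; module ≡-Reasoning)

length-filter-∁ : ∀ {a p} {A : Set a} {P : Pred A p} (P? : Decidable P) (xs : List A) →
                  length xs ≡ length (filter P? xs) + length (filter (∁? P?) xs)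
length-filter-∁ P? []       = refl
length-filter-∁ P? (x ∷ xs) with does (P? x)
... | true  = cong suc (length-filter-∁ P? xs)
... | false = trans (cong suc (length-filter-∁ P? xs))
                    (sym (+-suc (length (filter P? xs)) _))

module Pigeonhole {a b} {X : Set a} {Y : Set b} (_≟Y_ : DecidableEquality Y) (f : X → Y) where

  fibre : Y → List X → List X
  fibre y = filter (λ x → f x ≟Y y)

  others : Y → List X → List X
  others b = filter (∁? (λ x → f x ≟Y b))

  length-fibre-filter : ∀ {p} {P : Pred X p} (P? : Decidable P) y xs →
                        length (fibre y (filter P? xs)) ≤ length (fibre y xs)
  length-fibre-filter P? y xs =
    length-mono-≤ (filter⁺ (λ x → f x ≟Y y) (λ x → f x ≟Y y) (λ { refl p → p })
                           (filter-⊆ P? xs))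

  others-⊆ : ∀ b ys xs → (∀ {x} → x ∈ xs → f x ∈ b ∷ ys) →
             ∀ {x} → x ∈ others b xs → f x ∈ ys
  others-⊆ b ys xs img x∈ with x∈xs , fx≢b ← ∈-filter⁻ (∁? (λ x → f x ≟Y b)) {xs = xs} x∈
                          with img x∈xs
  ... | here fx≡b   = contradiction fx≡b fx≢b
  ... | there fx∈ys = fx∈ys

  length-fibre+others : ∀ b y k xs → length (others b xs) ≤ k * length (fibre y (others b xs)) →
                        length xs ≤ length (fibre b xs) + k * length (fibre y xs)
  length-fibre+others b y k xs others≤ = begin
    length xs                                    ≡⟨ length-filter-∁ (λ x → f x ≟Y b) xs ⟩
    length (fibre b xs) + length (others b xs)   ≤⟨ +-monoʳ-≤ (length (fibre b xs))
                                                      (≤-trans others≤ (*-monoʳ-≤ k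
                                                        (length-fibre-filter _ y xs))) ⟩
    length (fibre b xs) + k * length (fibre y xs) ∎
    where open ≤-Reasoning

  larger-fibre : ∀ b y k xs → length xs ≤ length (fibre b xs) + k * length (fibre y xs) →
                 ∃[ z ] length xs ≤ suc k * length (fibre z xs)
  larger-fibre b y k xs le with ≤-total (length (fibre y xs)) (length (fibre b xs))
  ... | inj₁ y≤b = b , ≤-trans le (+-monoʳ-≤ (length (fibre b xs)) (*-monoʳ-≤ k y≤b))
  ... | inj₂ b≤y = y , ≤-trans le (+-monoˡ-≤ (k * length (fibre y xs)) b≤y)

  pigeonhole : Y → (ys : List Y) (xs : List X) → (∀ {x} → x ∈ xs → f x ∈ ys) →
               ∃[ y ] length xs ≤ length ys * length (fibre y xs)
  pigeonhole y₀ []       []      _   = y₀ , z≤n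
  pigeonhole y₀ []       (x ∷ _) img with () ← img (here refl)
  pigeonhole y₀ (b ∷ ys) xs      img
    with y , ih ← pigeonhole y₀ ys (others b xs) (others-⊆ b ys xs img)
    = larger-fibre b y (length ys) xs (length-fibre+others b y (length ys) xs ih)

length-cartesianProductWith : ∀ {a b c} {A : Set a} {B : Set b} {C : Set c} (f : A → B → C) xs ys →
  length (cartesianProductWith f xs ys) ≡ length xs * length ys
length-cartesianProductWith f []       ys = refl
length-cartesianProductWith f (x ∷ xs) ys = begin
  length (map (f x) ys ++ cartesianProductWith f xs ys)
    ≡⟨ length-++ (map (f x) ys) ⟩
  length (map (f x) ys) + length (cartesianProductWith f xs ys)
    ≡⟨ cong₂ _+_ (length-map (f x) ys) (length-cartesianProductWith f xs ys) ⟩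
  length ys + length xs * length ys ∎
  where open ≡-Reasoning

listsUpTo : ∀ {a} {A : Set a} → List A → ℕ → List (List A)
listsUpTo as zero    = [ [] ]
listsUpTo as (suc j) = [] ∷ cartesianProductWith _∷_ as (listsUpTo as j)

∈-listsUpTo : ∀ {a} {A : Set a} {as : List A} j xs → All (_∈ as) xs → length xs ≤ j →
              xs ∈ listsUpTo as j
∈-listsUpTo zero    []       _           _         = here refl
∈-listsUpTo (suc j) []       _           _         = here refl
∈-listsUpTo (suc j) (x ∷ xs) (x∈ All.∷ xs⊆) (s≤s ≤j) =
  there (∈-cartesianProductWith⁺ _∷_ x∈ (∈-listsUpTo j xs xs⊆ ≤j))

length-listsUpTo-< : ∀ {a} {A : Set a} (as : List A) j → 2 ≤ length as →
                     length (listsUpTo as j) < length as ^ suc j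
length-listsUpTo-< as zero    2≤S rewrite *-identityʳ (length as) = 2≤S
length-listsUpTo-< as (suc j) 2≤S
  rewrite length-cartesianProductWith _∷_ as (listsUpTo as j) = begin
    2 + S * length (listsUpTo as j)   ≤⟨ +-monoˡ-≤ _ 2≤S ⟩
    S + S * length (listsUpTo as j)   ≡⟨ sym (*-suc S _) ⟩
    S * suc (length (listsUpTo as j)) ≤⟨ *-monoʳ-≤ S (length-listsUpTo-< as j 2≤S) ⟩
    S * S ^ suc j                     ∎
  where
  S = length as
  open ≤-Reasoning

length-listsUpTo : ∀ {a} {A : Set a} (as : List A) j → suc j ≤ length as →
                   length (listsUpTo as j) ≤ length as ^ suc j
length-listsUpTo as zero    1≤S rewrite *-identityʳ (length as) = 1≤S
length-listsUpTo as (suc j) 2+j≤S =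
  <⇒≤ (length-listsUpTo-< as (suc j) (≤-trans (s≤s (s≤s z≤n)) 2+j≤S))

-- `just l`: the I/O accesses the live block node labelled l; `nothing`: it creates a fresh label.
accessedLabel : ℕ → GState → ℕ → Maybe ℕ
accessedLabel N s a with a <ᵇ (N + N) | indexOf a (seen s) 0
... | true  | _           = just a
... | false | (true , k)  = just (N + N + k)
... | false | (false , _) = nothing

-- The graph construction only ever uses the number of non-input/output blocks seen so far,
-- never their addresses.
record LabelState : Set where
  constructor mkL
  field
    #fresh : ℕ
    lver   : ℕ → ℕ
    lmemIx : ℕ
    lcount : ℕ
    lnodes : List Node
    ledges : List Edge
open LabelState

forgetAddresses : GState → LabelState
forgetAddresses s = mkL (length (seen s)) (ver s) (memIx s) (count s) (gnodes s) (gedges s)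

labelAccess : ℕ → LabelState → Maybe ℕ → LabelState
labelAccess N s (just l) =
  let v = lver s l ; mn = mem (lmemIx s)
  in mkL (#fresh s) (setVer (lver s) l (suc v)) (lmemIx s) (lcount s)
         (lnodes s ++ (blk l (suc v) ∷ []))
         (ledges s ++ ((blk l v , mn) ∷ (mn , blk l (suc v)) ∷ []))
labelAccess N s nothing =
  let l = N + N + #fresh s ; mn = mem (lmemIx s)
  in mkL (#fresh s + 1) (setVer (lver s) l 0) (lmemIx s) (lcount s)
         (lnodes s ++ (blk l 0 ∷ []))
         (ledges s ++ ((mn , blk l 0) ∷ []))

labelEpoch : ℕ → LabelState → LabelState
labelEpoch e s with does (e ∣? suc (lcount s))
... | false = mkL (#fresh s) (lver s) (lmemIx s) (suc (lcount s)) (lnodes s) (ledges s)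
... | true  = mkL (#fresh s) (lver s) (suc (lmemIx s)) (suc (lcount s))
                  (lnodes s ++ (mem (suc (lmemIx s)) ∷ []))
                  (ledges s ++ ((mem (lmemIx s) , mem (suc (lmemIx s))) ∷ []))

labelStep : (N e : ℕ) → LabelState → Maybe ℕ → LabelState
labelStep N e s c = labelEpoch e (labelAccess N s c)

forgetAddresses-ioStep : ∀ N e s a →
  forgetAddresses (ioStep N e s a) ≡ labelStep N e (forgetAddresses s) (accessedLabel N s a)
forgetAddresses-ioStep N e s a with a <ᵇ (N + N) | indexOf a (seen s) 0
... | true  | (true , _) with does (e ∣? suc (count s))
...   | true  = refl
...   | false = refl
forgetAddresses-ioStep N e s a | true  | (false , _) with does (e ∣? suc (count s))
...   | true  = refl
...   | false = refl
forgetAddresses-ioStep N e s a | false | (true , _) with does (e ∣? suc (count s))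
...   | true  = refl
...   | false = refl
forgetAddresses-ioStep N e s a | false | (false , _) with does (e ∣? suc (count s))
...   | true  rewrite length-++ (seen s) {a ∷ []} = refl
...   | false rewrite length-++ (seen s) {a ∷ []} = refl

labelsOf : (N e : ℕ) → GState → List ℕ → List (Maybe ℕ)
labelsOf N e s []       = []
labelsOf N e s (a ∷ as) = accessedLabel N s a ∷ labelsOf N e (ioStep N e s a) as

foldLabels : (N e : ℕ) → LabelState → List (Maybe ℕ) → LabelState
foldLabels N e s []       = s
foldLabels N e s (c ∷ cs) = foldLabels N e (labelStep N e s c) cs

forgetAddresses-foldIO : ∀ N e s as →
  forgetAddresses (foldIO N e s as) ≡ foldLabels N e (forgetAddresses s) (labelsOf N e s as)
forgetAddresses-foldIO N e s []       = refl
forgetAddresses-foldIO N e s (a ∷ as) =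
  trans (forgetAddresses-foldIO N e (ioStep N e s a) as)
        (cong (λ s′ → foldLabels N e s′ (labelsOf N e (ioStep N e s a) as))
              (forgetAddresses-ioStep N e s a))

graphOfLabels : (N e : ℕ) → List (Maybe ℕ) → IOGraph
graphOfLabels N e cs =
  let s = foldLabels N e (forgetAddresses (initGState N)) cs in mkG (lnodes s) (ledges s)

ioGraphOfTrace≡graphOfLabels : ∀ N e tr →
  ioGraphOfTrace N e tr ≡ graphOfLabels N e (labelsOf N e (initGState N) tr)
ioGraphOfTrace≡graphOfLabels N e tr =
  cong (λ s → mkG (lnodes s) (ledges s)) (forgetAddresses-foldIO N e (initGState N) tr)

length-labelsOf : ∀ N e s as → length (labelsOf N e s as) ≡ length as
length-labelsOf N e s []       = refl
length-labelsOf N e s (a ∷ as) = cong suc (length-labelsOf N e (ioStep N e s a) as)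

#fresh-labelEpoch : ∀ e s → #fresh (labelEpoch e s) ≡ #fresh s
#fresh-labelEpoch e s with does (e ∣? suc (lcount s))
... | true  = refl
... | false = refl

#fresh-labelStep : ∀ N e s c → #fresh (labelStep N e s c) ≤ suc (#fresh s)
#fresh-labelStep N e s (just l) rewrite #fresh-labelEpoch e (labelAccess N s (just l)) = n≤1+n _
#fresh-labelStep N e s nothing  rewrite #fresh-labelEpoch e (labelAccess N s nothing) =
  ≤-reflexive (+-comm (#fresh s) 1)

length-seen-ioStep : ∀ N e s a → length (seen (ioStep N e s a)) ≤ suc (length (seen s))
length-seen-ioStep N e s a rewrite cong #fresh (forgetAddresses-ioStep N e s a) =
  #fresh-labelStep N e (forgetAddresses s) (accessedLabel N s a)

indexOf-< : ∀ a xs i k → indexOf a xs i ≡ (true , k) → k < i + length xs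
indexOf-< a (x ∷ xs) i k eq with a ≡ᵇ x
... | true  with refl ← eq = m<m+n i (s≤s z≤n)
... | false rewrite +-suc i (length xs) = indexOf-< a xs (suc i) k eq

labelAlphabet : ℕ → ℕ → List (Maybe ℕ)
labelAlphabet N t = nothing ∷ map just (upTo (N + N + t))

length-labelAlphabet : ∀ N t → length (labelAlphabet N t) ≡ t + 2 * N + 1
length-labelAlphabet N t = begin
  suc (length (map just (upTo (N + N + t)))) ≡⟨ cong suc (length-map just (upTo (N + N + t))) ⟩
  suc (length (upTo (N + N + t)))            ≡⟨ cong suc (length-upTo (N + N + t)) ⟩
  suc (N + N + t)                            ≡⟨ rearrange N t ⟩
  t + 2 * N + 1                              ∎
  where
  open ≡-Reasoning
  rearrange : ∀ N t → suc (N + N + t) ≡ t + 2 * N + 1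
  rearrange = solve-∀

accessedLabel-∈ : ∀ N t s a → length (seen s) < t → accessedLabel N s a ∈ labelAlphabet N t
accessedLabel-∈ N t s a seen<t with a <ᵇ (N + N) in a<ᵇ2N | indexOf a (seen s) 0 in index≡k
... | true  | _ = there (∈-map⁺ just (∈-upTo⁺
  (≤-trans (<ᵇ⇒< a (N + N) (subst T (sym a<ᵇ2N) tt)) (m≤m+n (N + N) t))))
... | false | (true , k) = there (∈-map⁺ just (∈-upTo⁺
  (+-monoʳ-< (N + N) (<-trans (indexOf-< a (seen s) 0 k index≡k) seen<t))))
... | false | (false , _) = here refl

labelsOf-∈ : ∀ N e t s as → length (seen s) + length as ≤ t →
             All (_∈ labelAlphabet N t) (labelsOf N e s as)
labelsOf-∈ N e t s []       _  = All.[]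
labelsOf-∈ N e t s (a ∷ as) ≤t =
  accessedLabel-∈ N t s a (<-≤-trans (m<m+n _ (s≤s z≤n)) ≤t) All.∷
  labelsOf-∈ N e t (ioStep N e s a) as (begin
    length (seen (ioStep N e s a)) + length as
      ≤⟨ +-monoˡ-≤ (length as) (length-seen-ioStep N e s a) ⟩
    suc (length (seen s)) + length as          ≡⟨ sym (+-suc (length (seen s)) (length as)) ⟩
    length (seen s) + length (a ∷ as)          ≤⟨ ≤t ⟩
    t                                          ∎)
  where open ≤-Reasoning

labelsOf-∈-listsUpTo : ∀ N e t tr → length tr ≤ t →
                       labelsOf N e (initGState N) tr ∈ listsUpTo (labelAlphabet N t) t
labelsOf-∈-listsUpTo N e t tr ≤t =
  ∈-listsUpTo t _ (labelsOf-∈ N e t (initGState N) tr ≤t)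
    (≤-trans (≤-reflexive (length-labelsOf N e (initGState N) tr)) ≤t)

length-listsUpTo-labelAlphabet : ∀ N t →
  length (listsUpTo (labelAlphabet N t) t) ≤ (t + 2 * N + 1) ^ (t + 1)
length-listsUpTo-labelAlphabet N t
  rewrite sym (length-labelAlphabet N t) | +-comm t 1 =
  length-listsUpTo (labelAlphabet N t) t (s≤s (begin
    t                                    ≤⟨ m≤n+m t (N + N) ⟩
    N + N + t                            ≡⟨ sym (length-upTo (N + N + t)) ⟩
    length (upTo (N + N + t))            ≡⟨ sym (length-map just (upTo (N + N + t))) ⟩
    length (map just (upTo (N + N + t))) ∎))
  where open ≤-Reasoning

length-trace-run : ∀ {w B M} (alg : Algorithm w B M) f m d → length (trace (run alg f m d)) ≤ f
length-trace-run alg f m d with step alg m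
length-trace-run alg zero    m d | halt        = z≤n
length-trace-run alg zero    m d | read _ _    = z≤n
length-trace-run alg zero    m d | write _ _ _ = z≤n
length-trace-run alg (suc f) m d | halt        = z≤n
length-trace-run alg (suc f) m d | read a k    = s≤s (length-trace-run alg f (k (d a)) d)
length-trace-run alg (suc f) m d | write a b m′ = s≤s (length-trace-run alg f m′ (updateDisk d a b))

≈G-reflexive : ∀ {G H} → G ≡ H → G ≈G H
≈G-reflexive refl = (λ _ → (λ p → p) , (λ p → p)) , (λ _ → (λ p → p) , (λ p → p))

lemma6 : (n w B M t : ℕ) → .{{_ : NonZero B}} → B ∣ n → B ≤ M →
    (alg : Algorithm w B M) →
    ((A : Matrix n w) → HaltsWithin alg t A) →
    (Σ (List (Matrix n w)) λ L →
       Unique L × All (Correct alg t) L × 2 ^ (n * n * w) ≤ 2 * length L) →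
    Σ (List (Matrix n w)) λ Γ →
      Unique Γ × All (Correct alg t) Γ ×
      ((A A′ : Matrix n w) → A ∈ Γ → A′ ∈ Γ → ioGraph alg t A ≈G ioGraph alg t A′) ×
      2 ^ (n * n * w) ≤ 2 * (t + 2 * nBlocks n B + 1) ^ (t + 1) * length Γ
lemma6 n w B M t _ _ alg _ (L , unique-L , correct-L , half-correct) =
  Γ , Unique.filter⁺ _ unique-L , All.filter⁺ _ correct-L ,
  (λ A A′ A∈Γ A′∈Γ → ≈G-reflexive (trans (ioGraph≡ A∈Γ) (sym (ioGraph≡ A′∈Γ)))) , bound
  where
  N e : ℕ
  N = nBlocks n B
  e = M / B

  labels : Matrix n w → List (Maybe ℕ)
  labels A = labelsOf N e (initGState N) (trace (runOn alg t A))

  sequences : List (List (Maybe ℕ))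
  sequences = listsUpTo (labelAlphabet N t) t

  open Pigeonhole (≡-dec (Maybe.≡-dec _≟_)) labels

  pigeon : ∃[ ℓ ] length L ≤ length sequences * length (fibre ℓ L)
  pigeon = pigeonhole [] sequences L
    (λ _ → labelsOf-∈-listsUpTo N e t _ (length-trace-run alg t _ _))

  Γ : List (Matrix n w)
  Γ = fibre (proj₁ pigeon) L

  ioGraph≡ : ∀ {A} → A ∈ Γ → ioGraph alg t A ≡ graphOfLabels N e (proj₁ pigeon)
  ioGraph≡ {A} A∈Γ = trans (ioGraphOfTrace≡graphOfLabels N e (trace (runOn alg t A)))
                           (cong (graphOfLabels N e) (proj₂ (∈-filter⁻ _ {xs = L} A∈Γ)))

  S : ℕ
  S = t + 2 * N + 1

  bound : 2 ^ (n * n * w) ≤ 2 * S ^ (t + 1) * length Γ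
  bound = begin
    2 ^ (n * n * w)                       ≤⟨ half-correct ⟩
    2 * length L                          ≤⟨ *-monoʳ-≤ 2 (proj₂ pigeon) ⟩
    2 * (length sequences * length Γ)     ≤⟨ *-monoʳ-≤ 2 (*-monoˡ-≤ (length Γ)
                                               (length-listsUpTo-labelAlphabet N t)) ⟩
    2 * (S ^ (t + 1) * length Γ)          ≡⟨ sym (*-assoc 2 (S ^ (t + 1)) (length Γ)) ⟩
    2 * S ^ (t + 1) * length Γ            ∎
    where open ≤-Reasoning
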